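{- Let $p,q$ be nonnegative integers and $n = 5p+9q$ with $n\ge 7$. Let $C_n(1,3)$ be the graph with vertex set $\{v_0,\dots,v_{n-1}\}$ and edge set $\{v_iv_{i+1}\}_{0\le i\le n-1}\cup\{v_iv_{i+3}\}_{0\le i\le n-1}$, indices modulo $n$. Then $\chi''(C_n(1,3)) = 5$.
   Context: A total $k$-colouring of a simple graph $G$ is a map $\sigma: V(G)\cup E(G)\to\{1,\dots,k\}$ such that adjacent vertices receive distinct colours, adjacent edges receive distinct colours, and each vertex receives a colour different from those of its incident edges. $\chi''(G)$ is the least such $k$. -}

module Defs where

open import Data.Nat using (ℕ; suc; _+_; _∸_; _%_; _≡ᵇ_; NonZero; _<_)
open import Data.Fin using (Fin; toℕ)
open import Data.Bool using (Bool; _∨_; T)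
open import Data.Product using (Σ; _×_; ∃)
open import Relation.Binary.PropositionalEquality using (_≡_; _≢_)
open import Relation.Nullary using (¬_)

-- A simple graph on vertex set Fin n is represented by its Boolean adjacency
-- function (the graphs used here are symmetric and loopless).
Graph : ℕ → Set
Graph n = Fin n → Fin n → Bool

-- A total k-colouring: vertex colours cv and edge colours ce, where the edge
-- {u,v} (with T (adj u v)) gets colour ce u v; ce is only meaningful on edges
-- and must not depend on the orientation of the edge.
record TotalColouring {n : ℕ} (G : Graph n) (k : ℕ) : Set where
  field
    cv : Fin n → Fin k
    ce : Fin n → Fin n → Fin k
    ce-sym : ∀ u v → T (G u v) → ce u v ≡ ce v u
    vert-proper : ∀ u v → T (G u v) → cv u ≢ cv v
    edge-proper : ∀ u v w → T (G u v) → T (G u w) → v ≢ w → ce u v ≢ ce u w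
    incid-proper : ∀ u v → T (G u v) → cv u ≢ ce u v

TotalChromaticNumber : {n : ℕ} → Graph n → ℕ → Set
TotalChromaticNumber G k =
  TotalColouring G k × (∀ j → j < k → ¬ TotalColouring G j)

-- Circulant adjacency of C_n(1,3): j - i ≡ ±1 or ±3 (mod n).
circAdj13 : (n : ℕ) → .{{_ : NonZero n}} → Fin n → Fin n → Bool
circAdj13 n i j =
  let d = (toℕ j + n ∸ toℕ i) % n in
  (d ≡ᵇ 1) ∨ (d ≡ᵇ 3) ∨ (d ≡ᵇ (n ∸ 1)) ∨ (d ≡ᵇ (n ∸ 3))

C13 : (n : ℕ) → Graph n
C13 ℕ.zero ()
C13 (suc n) = circAdj13 (suc n)

{-# OPTIONS --safe #-}
module Submission where

open import Defs
open import Data.Nat using (ℕ; _+_; _*_; _≥_)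
open import Relation.Binary.PropositionalEquality using (_≡_)

open import Data.Bool using (Bool; T; _∨_)
open import Data.Bool.Properties using (T-∨)
open import Data.Empty using (⊥-elim)
open import Data.Fin using (Fin; toℕ; #_; zero; suc)
open import Data.Fin.Properties
  using (toℕ-injective; toℕ-fromℕ<; toℕ<n; suc-injective; 0≢1+n; injective⇒≤; any?; all?)
  renaming (_≟_ to _≟ᶠ_)
open import Data.List using (List; []; _∷_; _++_; map; replicate)
open import Data.List.Properties using (map-++)
open import Data.Nat using (zero; suc; _∸_; _%_; _<_; _≤_; _<?_; _≡ᵇ_; NonZero; z≤n; s≤s; z<s; s<s)
open import Data.Nat.Divisibility using (∣-refl)
open import Data.Nat.DivMod
  using (_mod_; m%n<n; m<n⇒m%n≡m; m%n%n≡m%n; [m+n]%n≡m%n; %-distribˡ-+; %-remove-+ˡ)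
open import Data.Nat.ListAction using (sum)
open import Data.Nat.ListAction.Properties using (sum-++)
open import Data.Nat.Properties
  using ( +-comm; +-assoc; *-zeroʳ; *-suc; ≤-refl; ≤-trans; <-trans; <-≤-trans; <⇒≤; <⇒≱; <-≤-connex
        ; m≤m+n; m≤n+m; m<n+m; n<1+n; +-mono-<; +-mono-<-≤; +-monoˡ-<; +-cancelˡ-<
        ; m∸n+n≡m; m+[n∸m]≡n; m+n∸m≡n; m<n+o⇒m∸n<o; m≤n⇒∃[o]m+o≡n; ≡ᵇ⇒≡; ≡⇒≡ᵇ; allUpTo?)
open import Data.Product using (∃; _,_)
open import Data.Sum using (inj₁; inj₂)
open import Data.Vec using ([]; _∷_; lookup)
open import Function using (_∘_)
open import Function.Bundles using (Equivalence)
open import Function.Definitions using (Injective)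
open import Relation.Binary.PropositionalEquality
  using (_≢_; refl; sym; trans; cong; cong₂; subst; subst₂; module ≡-Reasoning)
open import Relation.Nullary using (Dec; yes; no; ¬_)
open import Relation.Nullary.Decidable using (map′; _→-dec_; decidable-stable; from-yes)

-- A vertex of C_n(1,3) and its four incident edges must get five different
-- colours.  Conversely, a total colouring is given by labelling every vertex
-- v_i with the colours of v_i, of v_i v_(i+1) and of v_i v_(i+3).  It is proper
-- as soon as, at every v_i, the labels of v_(i-3), v_(i-1), v_i are locally
-- proper: v_i and its four incident edges have distinct colours and v_i
-- differs from v_(i-1) and v_(i-3) (v_(i+1) and v_(i+3) are checked at those
-- vertices).  There are words of labels of lengths 5 and 9 all of whose
-- windows are locally proper, also across the seam into a following word of
-- either kind; read cyclically, the concatenation of p words of length 5 and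
-- q words of length 9 is therefore a total 5-colouring of C_(5p+9q)(1,3).

injective? : ∀ {m n} (f : Fin m → Fin n) → Dec (Injective _≡_ _≡_ f)
injective? f = map′ (λ inj {i} {j} → inj i j) (λ inj i j → inj)
  (all? λ i → all? λ j → (f i ≟ᶠ f j) →-dec (i ≟ᶠ j))

module _ {n} {G : Graph n} {k} (C : TotalColouring G k) where
  open TotalColouring C

  star : ∀ {d} → Fin n → (Fin d → Fin n) → Fin (suc d) → Fin k
  star u nbr zero    = cv u
  star u nbr (suc i) = ce u (nbr i)

  star-injective : ∀ {d} u (nbr : Fin d → Fin n) → Injective _≡_ _≡_ nbr →
                   (∀ i → T (G u (nbr i))) → Injective _≡_ _≡_ (star u nbr)
  star-injective u nbr nbr-inj adj {zero}  {zero}  _  = refl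
  star-injective u nbr nbr-inj adj {zero}  {suc j} eq = ⊥-elim (incid-proper u (nbr j) (adj j) eq)
  star-injective u nbr nbr-inj adj {suc i} {zero}  eq = ⊥-elim (incid-proper u (nbr i) (adj i) (sym eq))
  star-injective u nbr nbr-inj adj {suc i} {suc j} eq = cong suc (nbr-inj (decidable-stable (nbr i ≟ᶠ nbr j)
    λ nbr-i≢nbr-j → edge-proper u (nbr i) (nbr j) (adj i) (adj j) nbr-i≢nbr-j eq))

  neighbours<colours : ∀ {d} u (nbr : Fin d → Fin n) → Injective _≡_ _≡_ nbr →
                       (∀ i → T (G u (nbr i))) → d < k
  neighbours<colours u nbr nbr-inj adj = injective⇒≤ (star-injective u nbr nbr-inj adj)

module Modular (N : ℕ) .{{_ : NonZero N}} where

  [m%n+o]%n≡[m+o]%n : ∀ m o → (m % N + o) % N ≡ (m + o) % N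
  [m%n+o]%n≡[m+o]%n m o = begin
    (m % N + o) % N          ≡⟨ %-distribˡ-+ (m % N) o N ⟩
    (m % N % N + o % N) % N  ≡⟨ cong (λ r → (r + o % N) % N) (m%n%n≡m%n m N) ⟩
    (m % N + o % N) % N      ≡⟨ %-distribˡ-+ m o N ⟨
    (m + o) % N              ∎
    where open ≡-Reasoning

  +-cancelʳ-% : ∀ {a b} c → c ≤ N → (a + c) % N ≡ (b + c) % N → a % N ≡ b % N
  +-cancelʳ-% {a} {b} c c≤N eq = trans (undo a) (trans (cong (λ r → (r + (N ∸ c)) % N) eq) (sym (undo b)))
    where
    open ≡-Reasoning
    undo : ∀ x → x % N ≡ ((x + c) % N + (N ∸ c)) % N
    undo x = begin
      x % N                        ≡⟨ [m+n]%n≡m%n x N ⟨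
      (x + N) % N                  ≡⟨ cong (λ r → (x + r) % N) (m+[n∸m]≡n c≤N) ⟨
      (x + (c + (N ∸ c))) % N      ≡⟨ cong (_% N) (+-assoc x c (N ∸ c)) ⟨
      (x + c + (N ∸ c)) % N        ≡⟨ [m%n+o]%n≡[m+o]%n (x + c) (N ∸ c) ⟨
      ((x + c) % N + (N ∸ c)) % N  ∎

  -- Opaque: unfolding u ⊕ j exposes an irrelevant proof that blocks
  -- unification; all its properties are derived from toℕ-⊕.
  infixl 6 _⊕_
  opaque
    _⊕_ : Fin N → ℕ → Fin N
    u ⊕ j = (toℕ u + j) mod N

    toℕ-⊕ : ∀ u j → toℕ (u ⊕ j) ≡ (toℕ u + j) % N
    toℕ-⊕ u j = toℕ-fromℕ< (m%n<n (toℕ u + j) N)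

  ⊕-⊕ : ∀ u i j → u ⊕ i ⊕ j ≡ u ⊕ (i + j)
  ⊕-⊕ u i j = toℕ-injective (begin
    toℕ (u ⊕ i ⊕ j)             ≡⟨ toℕ-⊕ (u ⊕ i) j ⟩
    (toℕ (u ⊕ i) + j) % N       ≡⟨ cong (λ r → (r + j) % N) (toℕ-⊕ u i) ⟩
    ((toℕ u + i) % N + j) % N   ≡⟨ [m%n+o]%n≡[m+o]%n (toℕ u + i) j ⟩
    (toℕ u + i + j) % N         ≡⟨ cong (_% N) (+-assoc (toℕ u) i j) ⟩
    (toℕ u + (i + j)) % N       ≡⟨ toℕ-⊕ u (i + j) ⟨
    toℕ (u ⊕ (i + j))           ∎)
    where open ≡-Reasoning

  ⊕-N : ∀ u → u ⊕ N ≡ u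
  ⊕-N u = toℕ-injective (trans (toℕ-⊕ u N) (trans ([m+n]%n≡m%n (toℕ u) N) (m<n⇒m%n≡m (toℕ<n u))))

  offset : Fin N → Fin N → ℕ
  offset u v = (toℕ v + N ∸ toℕ u) % N

  ⊕-offset : ∀ u v → u ⊕ offset u v ≡ v
  ⊕-offset u v = toℕ-injective (begin
    toℕ (u ⊕ offset u v)                  ≡⟨ toℕ-⊕ u (offset u v) ⟩
    (toℕ u + offset u v) % N              ≡⟨ cong (_% N) (+-comm (toℕ u) (offset u v)) ⟩
    (offset u v + toℕ u) % N              ≡⟨ [m%n+o]%n≡[m+o]%n (toℕ v + N ∸ toℕ u) (toℕ u) ⟩
    (toℕ v + N ∸ toℕ u + toℕ u) % N       ≡⟨ cong (_% N) (m∸n+n≡m u≤v+N) ⟩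
    (toℕ v + N) % N                       ≡⟨ [m+n]%n≡m%n (toℕ v) N ⟩
    toℕ v % N                             ≡⟨ m<n⇒m%n≡m (toℕ<n v) ⟩
    toℕ v                                 ∎)
    where
    open ≡-Reasoning
    u≤v+N : toℕ u ≤ toℕ v + N
    u≤v+N = ≤-trans (<⇒≤ (toℕ<n u)) (m≤n+m N (toℕ v))

  offset-⊕ : ∀ u {j} → j < N → offset u (u ⊕ j) ≡ j
  offset-⊕ u {j} j<N = begin
    offset u (u ⊕ j)        ≡⟨ m%n%n≡m%n (toℕ (u ⊕ j) + N ∸ toℕ u) N ⟨
    offset u (u ⊕ j) % N    ≡⟨ +-cancelʳ-% (toℕ u) (<⇒≤ (toℕ<n u)) same-shift ⟩
    j % N                   ≡⟨ m<n⇒m%n≡m j<N ⟩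
    j                       ∎
    where
    open ≡-Reasoning
    same-shift : (offset u (u ⊕ j) + toℕ u) % N ≡ (j + toℕ u) % N
    same-shift = begin
      (offset u (u ⊕ j) + toℕ u) % N   ≡⟨ cong (_% N) (+-comm (offset u (u ⊕ j)) (toℕ u)) ⟩
      (toℕ u + offset u (u ⊕ j)) % N   ≡⟨ toℕ-⊕ u (offset u (u ⊕ j)) ⟨
      toℕ (u ⊕ offset u (u ⊕ j))       ≡⟨ cong toℕ (⊕-offset u (u ⊕ j)) ⟩
      toℕ (u ⊕ j)                      ≡⟨ toℕ-⊕ u j ⟩
      (toℕ u + j) % N                  ≡⟨ cong (_% N) (+-comm (toℕ u) j) ⟩
      (j + toℕ u) % N                  ∎

record Label (c : ℕ) : Set where
  constructor label
  field
    vertex edge₁ edge₃ : Fin c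
open Label

-- x, y, z are the labels of v_(i-3), v_(i-1), v_i.
colours : ∀ {c} → Label c → Label c → Label c → Fin 5 → Fin c
colours x y z = lookup (vertex z ∷ edge₁ z ∷ edge₃ z ∷ edge₁ y ∷ edge₃ x ∷ [])

record LocallyProper {c} (x y z : Label c) : Set where
  constructor locallyProper
  field
    colours-injective : Injective _≡_ _≡_ (colours x y z)
    vertex≢previous₁  : vertex z ≢ vertex y
    vertex≢previous₃  : vertex z ≢ vertex x
open LocallyProper

locallyProper? : ∀ {c} (x y z : Label c) → Dec (LocallyProper x y z)
locallyProper? x y z with injective? (colours x y z) | vertex z ≟ᶠ vertex y | vertex z ≟ᶠ vertex x
... | yes inj  | no ≢₁   | no ≢₃   = yes (locallyProper inj ≢₁ ≢₃)
... | no ¬inj  | _       | _       = no λ p → ¬inj (colours-injective p)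
... | _        | yes z≡y | _       = no λ p → vertex≢previous₁ p z≡y
... | _        | _       | yes z≡x = no λ p → vertex≢previous₃ p z≡x

-- For P = LocallyProper, the window at i is the condition at position i + 3.
Window : {A : Set} → (A → A → A → Set) → (ℕ → A) → ℕ → Set
Window P s i = P (s i) (s (i + 2)) (s (i + 3))

window-cong : ∀ {A : Set} (P : A → A → A → Set) {s t : ℕ → A} {i j} →
              s i ≡ t j → s (i + 2) ≡ t (j + 2) → s (i + 3) ≡ t (j + 3) → Window P s i → Window P t j
window-cong P e₀ e₂ e₃ w = subst₂ (P _) e₂ e₃ (subst (λ a → P a _ _) e₀ w)

module Concatenation {A Block : Set} (size : Block → ℕ) (entry : Block → ℕ → A)
                     (3≤size : ∀ X → 3 ≤ size X) where

  infixr 5 _▹_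
  _▹_ : Block → (ℕ → A) → ℕ → A
  (X ▹ s) i with i <? size X
  ... | yes _ = entry X i
  ... | no _  = s (i ∸ size X)

  ▹-below : ∀ X s {i} → i < size X → (X ▹ s) i ≡ entry X i
  ▹-below X s {i} i<size with i <? size X
  ... | yes _       = refl
  ... | no i≮size   = ⊥-elim (i≮size i<size)

  ▹-shift : ∀ X s i → (X ▹ s) (size X + i) ≡ s i
  ▹-shift X s i with size X + i <? size X
  ... | yes overflow = ⊥-elim (<⇒≱ overflow (m≤m+n (size X) i))
  ... | no _         = cong s (m+n∸m≡n (size X) i)

  ▹-cong : ∀ X {s t} → (∀ {j} → j < 3 → s j ≡ t j) → ∀ {i} → i < size X + 3 → (X ▹ s) i ≡ (X ▹ t) i
  ▹-cong X s≡t {i} i<size+3 with i <? size X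
  ... | yes _ = refl
  ... | no _  = s≡t (m<n+o⇒m∸n<o i (size X) i<size+3)

  word : List Block → Block → ℕ → A
  word []       Y = entry Y
  word (X ∷ xs) Y = X ▹ word xs Y

  first : List Block → Block → Block
  first []      Y = Y
  first (X ∷ _) _ = X

  total : List Block → ℕ
  total xs = sum (map size xs)

  word-prefix : ∀ xs Y {j} → j < 3 → word xs Y j ≡ entry (first xs Y) j
  word-prefix []       Y j<3 = refl
  word-prefix (X ∷ xs) Y j<3 = ▹-below X (word xs Y) (≤-trans j<3 (3≤size X))

  word-beyond : ∀ xs Y j → word xs Y (total xs + j) ≡ entry Y j
  word-beyond []       Y j = refl
  word-beyond (X ∷ xs) Y j = begin
    (X ▹ word xs Y) (size X + total xs + j)    ≡⟨ cong (X ▹ word xs Y) (+-assoc (size X) (total xs) j) ⟩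
    (X ▹ word xs Y) (size X + (total xs + j))  ≡⟨ ▹-shift X (word xs Y) (total xs + j) ⟩
    word xs Y (total xs + j)                   ≡⟨ word-beyond xs Y j ⟩
    entry Y j                                  ∎
    where open ≡-Reasoning

  word-seam : ∀ X ys {j} → j < 3 → word (X ∷ ys) X (total (X ∷ ys) + j) ≡ word (X ∷ ys) X j
  word-seam X ys j<3 = trans (word-beyond (X ∷ ys) X _) (sym (word-prefix (X ∷ ys) X j<3))

  total-++ : ∀ xs ys → total (xs ++ ys) ≡ total xs + total ys
  total-++ xs ys = trans (cong sum (map-++ size xs ys)) (sum-++ (map size xs) (map size ys))

  total-replicate : ∀ p X → total (replicate p X) ≡ size X * p
  total-replicate zero    X = sym (*-zeroʳ (size X))
  total-replicate (suc p) X = trans (cong (size X +_) (total-replicate p X)) (sym (*-suc (size X) p))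

  module _ (P : A → A → A → Set)
           (seams : ∀ X Y {i} → i < size X → Window P (X ▹ entry Y) i) where

    word-windows : ∀ xs Y {i} → i < total xs → Window P (word xs Y) i
    word-windows (X ∷ xs) Y {i} i<total with <-≤-connex i (size X)
    ... | inj₁ i<size = window-cong P {s = X ▹ entry (first xs Y)} {t = X ▹ word xs Y}
                         (agree (<-≤-trans i<size (m≤m+n (size X) 3)))
                         (agree (+-mono-< i<size (n<1+n 2))) (agree (+-monoˡ-< 3 i<size))
                         (seams X (first xs Y) i<size)
      where
      agree : ∀ {j} → j < size X + 3 → (X ▹ entry (first xs Y)) j ≡ (X ▹ word xs Y) j
      agree = ▹-cong X (λ j<3 → sym (word-prefix xs Y j<3))
    ... | inj₂ size≤i with m≤n⇒∃[o]m+o≡n size≤i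
    ...   | i′ , refl = window-cong P {s = word xs Y} {t = X ▹ word xs Y}
                          (sym (▹-shift X (word xs Y) i′)) (sym (shifted 2)) (sym (shifted 3))
                          (word-windows xs Y (+-cancelˡ-< (size X) i′ (total xs) i<total))
      where
      shifted : ∀ d → (X ▹ word xs Y) (size X + i′ + d) ≡ word xs Y (i′ + d)
      shifted d = trans (cong (X ▹ word xs Y) (+-assoc (size X) i′ d)) (▹-shift X (word xs Y) (i′ + d))

-- Steps are Fin 4 so that the neighbours of a vertex form a map Fin 4 → Fin N.
Step : Set
Step = Fin 4

pattern fwd₁ = zero
pattern fwd₃ = suc zero
pattern bwd₁ = suc (suc zero)
pattern bwd₃ = suc (suc (suc zero))

reverse : Step → Step
reverse fwd₁ = bwd₁
reverse fwd₃ = bwd₃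
reverse bwd₁ = fwd₁
reverse bwd₃ = fwd₃

-- With N = 7 + k the strides 1, 3, N ∸ 1, N ∸ 3 are distinct by computation.
module Circulant13 (k : ℕ) where

  N : ℕ
  N = 7 + k

  open Modular N public

  3<N : 3 < N
  3<N = s<s (s<s (s<s z<s))

  stride : Step → ℕ
  stride fwd₁ = 1
  stride fwd₃ = 3
  stride bwd₁ = N ∸ 1
  stride bwd₃ = N ∸ 3

  stride<N : ∀ i → stride i < N
  stride<N fwd₁ = s<s z<s
  stride<N fwd₃ = 3<N
  stride<N bwd₁ = n<1+n (N ∸ 1)
  stride<N bwd₃ = s<s (s<s (s<s (s<s (m<n+m k z<s))))

  stride-injective : Injective _≡_ _≡_ stride
  stride-injective {fwd₁} {fwd₁} _ = refl
  stride-injective {fwd₃} {fwd₃} _ = refl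
  stride-injective {bwd₁} {bwd₁} _ = refl
  stride-injective {bwd₃} {bwd₃} _ = refl
  stride-injective {fwd₁} {fwd₃} ()
  stride-injective {fwd₁} {bwd₁} ()
  stride-injective {fwd₁} {bwd₃} ()
  stride-injective {fwd₃} {bwd₁} ()
  stride-injective {fwd₃} {bwd₃} ()
  stride-injective {bwd₁} {bwd₃} ()

  stride+stride-reverse : ∀ i → stride i + stride (reverse i) ≡ N
  stride+stride-reverse fwd₁ = refl
  stride+stride-reverse fwd₃ = refl
  stride+stride-reverse bwd₁ = +-comm (N ∸ 1) 1
  stride+stride-reverse bwd₃ = +-comm (N ∸ 3) 3

  -- C13 N u v unfolds to isStride (offset u v).
  isStride : ℕ → Bool
  isStride d = (d ≡ᵇ 1) ∨ (d ≡ᵇ 3) ∨ (d ≡ᵇ (N ∸ 1)) ∨ (d ≡ᵇ (N ∸ 3))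

  isStride⇒stride : ∀ d → T (isStride d) → ∃ λ i → stride i ≡ d
  isStride⇒stride d adj with Equivalence.to T-∨ adj
  ... | inj₁ is₁ = fwd₁ , sym (≡ᵇ⇒≡ d 1 is₁)
  ... | inj₂ adj′ with Equivalence.to T-∨ adj′
  ...   | inj₁ is₃ = fwd₃ , sym (≡ᵇ⇒≡ d 3 is₃)
  ...   | inj₂ adj″ with Equivalence.to T-∨ adj″
  ...     | inj₁ isN-1 = bwd₁ , sym (≡ᵇ⇒≡ d (N ∸ 1) isN-1)
  ...     | inj₂ isN-3 = bwd₃ , sym (≡ᵇ⇒≡ d (N ∸ 3) isN-3)

  isStride-stride : ∀ i → T (isStride (stride i))
  isStride-stride fwd₁ = _
  isStride-stride fwd₃ = _
  isStride-stride bwd₁ = Equivalence.from T-∨ (inj₁ (≡⇒≡ᵇ (N ∸ 1) (N ∸ 1) refl))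
  isStride-stride bwd₃ = Equivalence.from T-∨ (inj₂ (≡⇒≡ᵇ (N ∸ 3) (N ∸ 3) refl))

  neighbour : Fin N → Step → Fin N
  neighbour u i = u ⊕ stride i

  neighbour-injective : ∀ u → Injective _≡_ _≡_ (neighbour u)
  neighbour-injective u {i} {j} eq = stride-injective (begin
    stride i                    ≡⟨ offset-⊕ u (stride<N i) ⟨
    offset u (neighbour u i)    ≡⟨ cong (offset u) eq ⟩
    offset u (neighbour u j)    ≡⟨ offset-⊕ u (stride<N j) ⟩
    stride j                    ∎)
    where open ≡-Reasoning

  neighbour-reverse : ∀ u i → neighbour (neighbour u i) (reverse i) ≡ u
  neighbour-reverse u i = trans (⊕-⊕ u (stride i) (stride (reverse i)))
    (trans (cong (u ⊕_) (stride+stride-reverse i)) (⊕-N u))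

  neighbour-adjacent : ∀ u i → T (C13 N u (neighbour u i))
  neighbour-adjacent u i = subst (T ∘ isStride) (sym (offset-⊕ u (stride<N i))) (isStride-stride i)

  adjacent⇒neighbour : ∀ u v → T (C13 N u v) → ∃ λ i → v ≡ neighbour u i
  adjacent⇒neighbour u v adj with isStride⇒stride (offset u v) adj
  ... | i , stride≡offset = i , trans (sym (⊕-offset u v)) (cong (u ⊕_) (sym stride≡offset))

  bwd₃⊕2≡bwd₁ : ∀ u → neighbour u bwd₃ ⊕ 2 ≡ neighbour u bwd₁
  bwd₃⊕2≡bwd₁ u = trans (⊕-⊕ u (N ∸ 3) 2) (cong (u ⊕_) (+-comm (N ∸ 3) 2))

  onNeighbours : ∀ {u} {P : Fin N → Set} → (∀ i → P (neighbour u i)) → ∀ v → T (C13 N u v) → P v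
  onNeighbours {u} p v adj with adjacent⇒neighbour u v adj
  ... | i , refl = p i

  five-colours-necessary : ∀ j → j < 5 → ¬ TotalColouring (C13 N) j
  five-colours-necessary j j<5 C =
    <⇒≱ j<5 (neighbours<colours C zero (neighbour zero) (neighbour-injective zero) (neighbour-adjacent zero))

  module _ {c} (L : Fin N → Label c)
           (proper : ∀ u → LocallyProper (L (neighbour u bwd₃)) (L (neighbour u bwd₁)) (L u)) where

    edgeColour : Fin N → Step → Fin c
    edgeColour u i = colours (L (neighbour u bwd₃)) (L (neighbour u bwd₁)) (L u) (suc i)

    edgeColour-reverse : ∀ u i → edgeColour (neighbour u i) (reverse i) ≡ edgeColour u i
    edgeColour-reverse u fwd₁ = cong (edge₁ ∘ L) (neighbour-reverse u fwd₁)
    edgeColour-reverse u fwd₃ = cong (edge₃ ∘ L) (neighbour-reverse u fwd₃)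
    edgeColour-reverse u bwd₁ = refl
    edgeColour-reverse u bwd₃ = refl

    -- The colour chosen when w is not a neighbour of u is never inspected.
    edgeColourIfNeighbour : ∀ u {w} → Dec (∃ λ i → w ≡ neighbour u i) → Fin c
    edgeColourIfNeighbour u (yes (i , _)) = edgeColour u i
    edgeColourIfNeighbour u (no _)        = vertex (L u)

    colourTowards : Fin N → Fin N → Fin c
    colourTowards u w = edgeColourIfNeighbour u (any? λ i → w ≟ᶠ neighbour u i)

    colourTowards-neighbour : ∀ u i → colourTowards u (neighbour u i) ≡ edgeColour u i
    colourTowards-neighbour u i = pick (any? λ j → neighbour u i ≟ᶠ neighbour u j)
      where
      pick : (found : Dec (∃ λ j → neighbour u i ≡ neighbour u j)) → edgeColourIfNeighbour u {neighbour u i} found ≡ edgeColour u i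
      pick (yes (j , i≡j)) = cong (edgeColour u) (sym (neighbour-injective u {i} {j} i≡j))
      pick (no none)       = ⊥-elim (none (i , refl))

    colourTowards-sym : ∀ u i → colourTowards u (neighbour u i) ≡ colourTowards (neighbour u i) u
    colourTowards-sym u i = begin
      colourTowards u (neighbour u i)                         ≡⟨ colourTowards-neighbour u i ⟩
      edgeColour u i                                          ≡⟨ edgeColour-reverse u i ⟨
      edgeColour v (reverse i)                                ≡⟨ colourTowards-neighbour v (reverse i) ⟨
      colourTowards v (neighbour v (reverse i))               ≡⟨ cong (colourTowards v) (neighbour-reverse u i) ⟩
      colourTowards v u                                       ∎
      where
      open ≡-Reasoning
      v : Fin N
      v = neighbour u i

    via-reverse : ∀ u i → vertex (L (neighbour u i)) ≢ vertex (L (neighbour (neighbour u i) (reverse i))) →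
                  vertex (L u) ≢ vertex (L (neighbour u i))
    via-reverse u i ≢back eq = ≢back (trans (sym eq) (cong (vertex ∘ L) (sym (neighbour-reverse u i))))

    vertex≢neighbour : ∀ u i → vertex (L u) ≢ vertex (L (neighbour u i))
    vertex≢neighbour u fwd₁ = via-reverse u fwd₁ (vertex≢previous₁ (proper (neighbour u fwd₁)))
    vertex≢neighbour u fwd₃ = via-reverse u fwd₃ (vertex≢previous₃ (proper (neighbour u fwd₃)))
    vertex≢neighbour u bwd₁ = vertex≢previous₁ (proper u)
    vertex≢neighbour u bwd₃ = vertex≢previous₃ (proper u)

    vertex≢edge : ∀ u i → vertex (L u) ≢ colourTowards u (neighbour u i)
    vertex≢edge u i eq = 0≢1+n (colours-injective (proper u) {zero} {suc i} (trans eq (colourTowards-neighbour u i)))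

    edges-distinct : ∀ u i j → neighbour u i ≢ neighbour u j →
                     colourTowards u (neighbour u i) ≢ colourTowards u (neighbour u j)
    edges-distinct u i j ≢nbr eq = ≢nbr (cong (neighbour u) (suc-injective (colours-injective (proper u) {suc i} {suc j}
      (trans (sym (colourTowards-neighbour u i)) (trans eq (colourTowards-neighbour u j))))))

    labelling⇒colouring : TotalColouring (C13 N) c
    labelling⇒colouring = record
      { cv           = vertex ∘ L
      ; ce           = colourTowards
      ; ce-sym       = λ u → onNeighbours (colourTowards-sym u)
      ; vert-proper  = λ u → onNeighbours (vertex≢neighbour u)
      ; edge-proper  = λ u v w adj-v adj-w →
                         onNeighbours (λ i → onNeighbours (edges-distinct u i) w adj-w) v adj-v
      ; incid-proper = λ u → onNeighbours (vertex≢edge u)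
      }

  module _ {c} (s : ℕ → Label c) (seam : ∀ {j} → j < 3 → s (N + j) ≡ s j) where

    wrap-% : ∀ {i} → i < N + 3 → s (i % N) ≡ s i
    wrap-% {i} i<N+3 with <-≤-connex i N
    ... | inj₁ i<N = cong s (m<n⇒m%n≡m i<N)
    ... | inj₂ N≤i with m≤n⇒∃[o]m+o≡n N≤i
    ...   | j , refl = begin
      s ((N + j) % N)  ≡⟨ cong s (%-remove-+ˡ j (∣-refl {N})) ⟩
      s (j % N)        ≡⟨ cong s (m<n⇒m%n≡m (<-trans j<3 3<N)) ⟩
      s j              ≡⟨ seam j<3 ⟨
      s (N + j)        ∎
      where
      open ≡-Reasoning
      j<3 : j < 3
      j<3 = +-cancelˡ-< N j 3 i<N+3

    wrap-⊕ : ∀ w {d} → d ≤ 3 → s (toℕ (w ⊕ d)) ≡ s (toℕ w + d)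
    wrap-⊕ w {d} d≤3 = trans (cong s (toℕ-⊕ w d)) (wrap-% (+-mono-<-≤ (toℕ<n w) d≤3))

    cyclic-proper : (∀ {i} → i < N → Window LocallyProper s i) →
                    ∀ u → LocallyProper (s (toℕ (neighbour u bwd₃))) (s (toℕ (neighbour u bwd₁))) (s (toℕ u))
    cyclic-proper windows u =
      subst₂ (LocallyProper (s (toℕ w))) (sym previous) (sym current) (windows (toℕ<n w))
      where
      w : Fin N
      w = neighbour u bwd₃
      previous : s (toℕ (neighbour u bwd₁)) ≡ s (toℕ w + 2)
      previous = trans (cong (s ∘ toℕ) (sym (bwd₃⊕2≡bwd₁ u))) (wrap-⊕ w (s≤s (s≤s z≤n)))
      current : s (toℕ u) ≡ s (toℕ w + 3)
      current = trans (cong (s ∘ toℕ) (sym (neighbour-reverse u bwd₃))) (wrap-⊕ w ≤-refl)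

data Block : Set where
  A B : Block

size : Block → ℕ
size A = 5
size B = 9

-- Entries past the size of a block are junk and never read.
entry : Block → ℕ → Label 5
entry A 0 = label (# 0) (# 1) (# 2)
entry A 1 = label (# 2) (# 0) (# 3)
entry A 2 = label (# 4) (# 1) (# 3)
entry A 3 = label (# 3) (# 0) (# 4)
entry A 4 = label (# 1) (# 4) (# 2)
entry B 0 = label (# 0) (# 2) (# 1)
entry B 1 = label (# 1) (# 3) (# 0)
entry B 2 = label (# 0) (# 4) (# 1)
entry B 3 = label (# 2) (# 3) (# 0)
entry B 4 = label (# 4) (# 2) (# 1)
entry B 5 = label (# 3) (# 4) (# 0)
entry B 6 = label (# 1) (# 2) (# 3)
entry B 7 = label (# 0) (# 3) (# 4)
entry B 8 = label (# 1) (# 4) (# 2)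
entry _ _ = label (# 0) (# 0) (# 0)

3≤size : ∀ X → 3 ≤ size X
3≤size A = s≤s (s≤s (s≤s z≤n))
3≤size B = s≤s (s≤s (s≤s z≤n))

open Concatenation size entry 3≤size

seam? : ∀ X Y → Dec (∀ {i} → i < size X → Window LocallyProper (X ▹ entry Y) i)
seam? X Y = allUpTo? (λ i → locallyProper? (s i) (s (i + 2)) (s (i + 3))) (size X)
  where
  s : ℕ → Label 5
  s = X ▹ entry Y

seams-proper : ∀ X Y {i} → i < size X → Window LocallyProper (X ▹ entry Y) i
seams-proper A A = from-yes (seam? A A)
seams-proper A B = from-yes (seam? A B)
seams-proper B A = from-yes (seam? B A)
seams-proper B B = from-yes (seam? B B)

blocks⇒colouring : ∀ k xs → total xs ≡ 7 + k → TotalColouring (C13 (7 + k)) 5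
blocks⇒colouring k (X ∷ ys) total≡N = labelling⇒colouring (s ∘ toℕ) (cyclic-proper s seam windows)
  where
  open Circulant13 k
  s : ℕ → Label 5
  s = word (X ∷ ys) X
  seam : ∀ {j} → j < 3 → s (N + j) ≡ s j
  seam {j} j<3 = trans (cong (λ t → s (t + j)) (sym total≡N)) (word-seam X ys j<3)
  windows : ∀ {i} → i < N → Window LocallyProper s i
  windows {i} i<N = word-windows LocallyProper seams-proper (X ∷ ys) X (subst (i <_) (sym total≡N) i<N)

lemma3 : (p q n : ℕ) → n ≡ 5 * p + 9 * q → n ≥ 7 → TotalChromaticNumber (C13 n) 5
lemma3 p q n n≡5p+9q n≥7 with m≤n⇒∃[o]m+o≡n n≥7
... | k , refl = blocks⇒colouring k blocks total≡n , Circulant13.five-colours-necessary k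
  where
  open ≡-Reasoning
  blocks : List Block
  blocks = replicate p A ++ replicate q B
  total≡n : total blocks ≡ 7 + k
  total≡n = begin
    total (replicate p A ++ replicate q B)         ≡⟨ total-++ (replicate p A) (replicate q B) ⟩
    total (replicate p A) + total (replicate q B)  ≡⟨ cong₂ _+_ (total-replicate p A) (total-replicate q B) ⟩
    5 * p + 9 * q                                  ≡⟨ n≡5p+9q ⟨
    7 + k                                          ∎
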